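{- Let $G$ be a finite simple connected graph on $n$ vertices and let $m$ be a positive integer such that for every subset $S$ of at most $m$ vertices, the graph $G-\overline{N}(S)$ has a connected component with more than $n/2$ vertices. Then $c_{\infty}(G)>m$.
   Context: For a set $A$ of vertices, $N(A)$ is the set of vertices having a neighbour in $A$ and $\overline{N}(A)=A\cup N(A)$; $G-X$ denotes the subgraph induced by $V(G)\setminus X$. Game with an unbounded-speed robber: on a graph $G$, a set of cops first choose vertices (several cops may share a vertex), then the robber, knowing their positions, chooses a vertex. Then the cops and the robber move alternately, cops first. In the cops' turn, each cop moves to an adjacent vertex or stays. In the robber's turn, she may move along any path of $G$ starting at her current vertex that contains no vertex currently occupied by a cop, or stay. The cops win if at some point a cop occupies the robber's vertex. $c_{\infty}(G)$ is the minimum number of cops that guarantees a cop win. -}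

module Defs where

open import Data.Nat using (ℕ; _≤_; _<_; _*_)
open import Data.Fin using (Fin)
open import Data.Fin.Subset using (Subset; _∈_; _∉_; ∣_∣)
open import Data.Product using (Σ; ∃; _×_; _,_)
open import Data.Sum using (_⊎_)
open import Data.Empty using (⊥)
open import Relation.Nullary using (¬_)
open import Relation.Binary using (Decidable)
open import Relation.Binary.PropositionalEquality using (_≡_)
open import Function.Bundles using (_⇔_)

record Graph (n : ℕ) : Set₁ where
  field
    Adj    : Fin n → Fin n → Set
    adj?   : Decidable Adj
    sym    : ∀ {u v} → Adj u v → Adj v u
    irrefl : ∀ {u} → ¬ Adj u u
open Graph public

module _ {n : ℕ} (G : Graph n) where

  -- Reach X u v : there is a path of G from u to v none of whose
  -- vertices (including u and v) lies in X; i.e. u, v are connected in G - X.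
  data Reach (X : Fin n → Set) : Fin n → Fin n → Set where
    here : ∀ {u} → ¬ X u → Reach X u u
    step : ∀ {u w v} → ¬ X u → Adj G u w → Reach X w v → Reach X u v

  Connected : Set
  Connected = ∀ u v → Reach (λ _ → ⊥) u v

  ClosedNbhd : Subset n → Fin n → Set
  ClosedNbhd S v = v ∈ S ⊎ Σ (Fin n) (λ u → u ∈ S × Adj G u v)

  IsComponent : (Fin n → Set) → Subset n → Set
  IsComponent X C = Σ (Fin n) λ v → ∀ w → (w ∈ C) ⇔ Reach X v w

  -- Cops and robber with an unbounded-speed robber, k cops.
  -- Cop positions: Fin k → Fin n.

  Occupied : {k : ℕ} → (Fin k → Fin n) → Fin n → Set
  Occupied c w = Σ _ λ i → c i ≡ w

  CopMove : {k : ℕ} → (Fin k → Fin n) → (Fin k → Fin n) → Set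
  CopMove c c' = ∀ i → c' i ≡ c i ⊎ Adj G (c i) (c' i)

  -- CopWin c r : cops at c, robber at r, cops to move; the cops can force
  -- capture in finitely many rounds (least fixed point / attractor).
  data CopWin {k : ℕ} : (Fin k → Fin n) → Fin n → Set where
    win : ∀ {c r} (c' : Fin k → Fin n) → CopMove c c' →
          (Occupied c' r ⊎ (∀ r' → Reach (Occupied c') r r' → CopWin c' r')) →
          CopWin c r

  CopsWin : ℕ → Set
  CopsWin k = Σ (Fin k → Fin n) λ c → ∀ r → Occupied c r ⊎ CopWin c r

  -- c∞(G) > m : every winning number of cops exceeds m
  -- (c∞(G) is the minimum k with CopsWin k).
  c∞> : ℕ → Set
  c∞> m = ∀ k → CopsWin k → m < k

-- The robber keeps to the majority component of G − N̄(cops).  Cops can only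
-- move inside the closed neighbourhood of their previous positions, so during
-- the cops' move the whole current component stays free.  Any two components
-- with more than n/2 vertices meet, so the robber runs to the next majority
-- component through the common vertex and is never caught.
module Submission where

open import Defs
open import Data.Nat using (ℕ; zero; suc; _≤_; _<_; _*_; _+_; _∸_; z≤n; s≤s)
open import Data.Nat.Properties
open import Data.Fin using (Fin; zero; suc)
open import Data.Fin.Subset
  using (Subset; ∣_∣; _∈_; _∪_; _∩_; ⁅_⁆; ∁; ⊥; inside; outside; Nonempty; Empty; _⊆_)
open import Data.Fin.Subset.Properties
open import Data.Vec using ([]; _∷_)
open import Data.Product using (Σ; _×_; _,_; proj₁; proj₂)
open import Data.Sum using (inj₁; inj₂; [_,_])
open import Data.Empty using (⊥-elim)
open import Relation.Nullary using (¬_; yes; no; contradiction)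
open import Relation.Binary.PropositionalEquality as ≡ using (refl; cong; subst)
open import Function using (_∘_)
open import Function.Bundles using (Equivalence)

∣p∪q∣≤∣p∣+∣q∣ : ∀ {n} (p q : Subset n) → ∣ p ∪ q ∣ ≤ ∣ p ∣ + ∣ q ∣
∣p∪q∣≤∣p∣+∣q∣ []            []            = z≤n
∣p∪q∣≤∣p∣+∣q∣ (outside ∷ p) (outside ∷ q) = ∣p∪q∣≤∣p∣+∣q∣ p q
∣p∪q∣≤∣p∣+∣q∣ (inside  ∷ p) (outside ∷ q) = s≤s (∣p∪q∣≤∣p∣+∣q∣ p q)
∣p∪q∣≤∣p∣+∣q∣ (outside ∷ p) (inside  ∷ q) =
  subst (suc ∣ p ∪ q ∣ ≤_) (≡.sym (+-suc ∣ p ∣ ∣ q ∣)) (s≤s (∣p∪q∣≤∣p∣+∣q∣ p q))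
∣p∪q∣≤∣p∣+∣q∣ (inside  ∷ p) (inside  ∷ q) =
  s≤s (≤-trans (∣p∪q∣≤∣p∣+∣q∣ p q) (+-monoʳ-≤ ∣ p ∣ (n≤1+n ∣ q ∣)))

Empty[p∩q]⇒∣p∣+∣q∣≤n : ∀ {n} (p q : Subset n) → Empty (p ∩ q) → ∣ p ∣ + ∣ q ∣ ≤ n
Empty[p∩q]⇒∣p∣+∣q∣≤n {n} p q disjoint = begin
  ∣ p ∣ + ∣ q ∣       ≤⟨ +-monoˡ-≤ ∣ q ∣ ∣p∣≤∣∁q∣ ⟩
  ∣ ∁ q ∣ + ∣ q ∣     ≡⟨ cong (_+ ∣ q ∣) (∣∁p∣≡n∸∣p∣ q) ⟩
  n ∸ ∣ q ∣ + ∣ q ∣   ≡⟨ m∸n+n≡m (∣p∣≤n q) ⟩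
  n                   ∎
  where
  open ≤-Reasoning
  p⊆∁q : p ⊆ ∁ q
  p⊆∁q {x} x∈p with x ∈? q
  ... | yes x∈q = contradiction (x , x∈p∩q⁺ (x∈p , x∈q)) disjoint
  ... | no  x∉q = x∉p⇒x∈∁p x∉q
  ∣p∣≤∣∁q∣ : ∣ p ∣ ≤ ∣ ∁ q ∣
  ∣p∣≤∣∁q∣ = p⊆q⇒∣p∣≤∣q∣ p⊆∁q

majorities-intersect : ∀ {n} (p q : Subset n) →
  n < 2 * ∣ p ∣ → n < 2 * ∣ q ∣ → Nonempty (p ∩ q)
majorities-intersect {n} p q n<2∣p∣ n<2∣q∣ with nonempty? (p ∩ q)
... | yes common = common
... | no  disjoint = contradiction (+-mono-< n<2∣p∣ n<2∣q∣) (≤⇒≯ (begin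
  2 * ∣ p ∣ + 2 * ∣ q ∣   ≡⟨ *-distribˡ-+ 2 ∣ p ∣ ∣ q ∣ ⟨
  2 * (∣ p ∣ + ∣ q ∣)     ≤⟨ *-monoʳ-≤ 2 (Empty[p∩q]⇒∣p∣+∣q∣≤n p q disjoint) ⟩
  2 * n                   ≡⟨ cong (n +_) (*-identityˡ n) ⟩
  n + n                   ∎))
  where open ≤-Reasoning

image : ∀ {n k} → (Fin k → Fin n) → Subset n
image {k = zero}  c = ⊥
image {k = suc k} c = ⁅ c zero ⁆ ∪ image (c ∘ suc)

∣image∣≤k : ∀ {n k} (c : Fin k → Fin n) → ∣ image c ∣ ≤ k
∣image∣≤k {n} {zero}  c = ≤-reflexive (∣⊥∣≡0 n)
∣image∣≤k {n} {suc k} c = begin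
  ∣ ⁅ c zero ⁆ ∪ image (c ∘ suc) ∣        ≤⟨ ∣p∪q∣≤∣p∣+∣q∣ ⁅ c zero ⁆ (image (c ∘ suc)) ⟩
  ∣ ⁅ c zero ⁆ ∣ + ∣ image (c ∘ suc) ∣    ≡⟨ cong (_+ ∣ image (c ∘ suc) ∣) (∣⁅x⁆∣≡1 (c zero)) ⟩
  suc ∣ image (c ∘ suc) ∣                 ≤⟨ s≤s (∣image∣≤k (c ∘ suc)) ⟩
  suc k                                   ∎
  where open ≤-Reasoning

c[i]∈image : ∀ {n k} (c : Fin k → Fin n) i → c i ∈ image c
c[i]∈image {k = suc k} c zero    = x∈p∪q⁺ (inj₁ (x∈⁅x⁆ (c zero)))
c[i]∈image {k = suc k} c (suc i) = x∈p∪q⁺ (inj₂ (c[i]∈image (c ∘ suc) i))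

module _ {n : ℕ} (G : Graph n) where

  reach-start : ∀ {X u v} → Reach G X u v → ¬ X u
  reach-start (here u∉X)     = u∉X
  reach-start (step u∉X _ _) = u∉X

  reach-end : ∀ {X u v} → Reach G X u v → ¬ X v
  reach-end (here v∉X)    = v∉X
  reach-end (step _ _ wv) = reach-end wv

  reach-trans : ∀ {X u v w} → Reach G X u v → Reach G X v w → Reach G X u w
  reach-trans (here _)             vw = vw
  reach-trans (step u∉X uw' w'v) vw = step u∉X uw' (reach-trans w'v vw)

  reach-sym : ∀ {X u v} → Reach G X u v → Reach G X v u
  reach-sym (here v∉X)       = here v∉X
  reach-sym (step u∉X uw wv) =
    reach-trans (reach-sym wv) (step (reach-start wv) (sym G uw) (here u∉X))

  reach-antimono : ∀ {X Y : Fin n → Set} → (∀ {x} → Y x → X x) →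
    ∀ {u v} → Reach G X u v → Reach G Y u v
  reach-antimono Y⊆X (here v∉X)       = here (v∉X ∘ Y⊆X)
  reach-antimono Y⊆X (step u∉X uw wv) = step (u∉X ∘ Y⊆X) uw (reach-antimono Y⊆X wv)

  component-connected : ∀ {X C u v} → IsComponent G X C →
    u ∈ C → v ∈ C → Reach G X u v
  component-connected {X} {C} (centre , ∈C⇔reach) u∈C v∈C =
    reach-trans (reach-sym (to u∈C)) (to v∈C)
    where
    to : ∀ {w} → w ∈ C → Reach G X centre w
    to {w} = Equivalence.to (∈C⇔reach w)

  occupied-after-move⇒ClosedNbhd : ∀ {k} {c c' : Fin k → Fin n} → CopMove G c c' →
    ∀ {w} → Occupied G c' w → ClosedNbhd G (image c) w
  occupied-after-move⇒ClosedNbhd {c = c} move (i , refl) with move i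
  ... | inj₁ stay = inj₁ (subst (_∈ image c) (≡.sym stay) (c[i]∈image c i))
  ... | inj₂ edge = inj₂ (c i , c[i]∈image c i , edge)

  -- T c is a territory where the robber is safe while the cops stand at c.
  module _ {k : ℕ} (T : (Fin k → Fin n) → Subset n)
    (T-connected : ∀ c {u v} → u ∈ T c → v ∈ T c → Reach G (ClosedNbhd G (image c)) u v)
    (T-overlap : ∀ c c' → Nonempty (T c ∩ T c')) where

    robber-not-caught : ∀ {c c' r} → CopMove G c c' → r ∈ T c → ¬ Occupied G c' r
    robber-not-caught {c} move r∈Tc =
      reach-end (T-connected c r∈Tc r∈Tc) ∘ occupied-after-move⇒ClosedNbhd move

    robber-survives : ∀ {c r} → r ∈ T c → ¬ CopWin G c r
    robber-survives r∈Tc (win c' move (inj₁ caught)) = robber-not-caught move r∈Tc caught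
    robber-survives {c} {r} r∈Tc (win c' move (inj₂ continue)) with T-overlap c c'
    ... | w , w∈Tc∩Tc' = robber-survives w∈Tc' (continue w escape)
      where
      w∈Tc : w ∈ T c
      w∈Tc = x∈p∩q⁻ (T c) (T c') w∈Tc∩Tc' .proj₁
      w∈Tc' : w ∈ T c'
      w∈Tc' = x∈p∩q⁻ (T c) (T c') w∈Tc∩Tc' .proj₂
      escape : Reach G (Occupied G c') r w
      escape = reach-antimono (occupied-after-move⇒ClosedNbhd move) (T-connected c r∈Tc w∈Tc)

    cops-lose : ¬ CopsWin G k
    cops-lose (c , strategy) with T-overlap c c
    ... | r , r∈Tc∩Tc = [ robber-not-caught (λ _ → inj₁ refl) r∈Tc , robber-survives r∈Tc ] (strategy r)
      where
      r∈Tc : r ∈ T c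
      r∈Tc = x∈p∩q⁻ (T c) (T c) r∈Tc∩Tc .proj₁

lemma3p2 : (n : ℕ) (G : Graph n) → Connected G → (m : ℕ) → 1 ≤ m →
    (∀ (S : Subset n) → ∣ S ∣ ≤ m →
      Σ (Subset n) λ C → IsComponent G (ClosedNbhd G S) C × n < 2 * ∣ C ∣) →
    c∞> G m
lemma3p2 n G _ m _ majority k copsWin with k ≤? m
... | no  k≰m = ≰⇒> k≰m
... | yes k≤m = ⊥-elim (cops-lose G T T-connected T-overlap copsWin)
  where
  component : (c : Fin k → Fin n) →
    Σ (Subset n) λ C → IsComponent G (ClosedNbhd G (image c)) C × n < 2 * ∣ C ∣
  component c = majority (image c) (≤-trans (∣image∣≤k c) k≤m)
  T : (Fin k → Fin n) → Subset n
  T c = component c .proj₁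
  T-connected : ∀ c {u v} → u ∈ T c → v ∈ T c → Reach G (ClosedNbhd G (image c)) u v
  T-connected c = component-connected G (component c .proj₂ .proj₁)
  T-overlap : ∀ c c' → Nonempty (T c ∩ T c')
  T-overlap c c' =
    majorities-intersect (T c) (T c') (component c .proj₂ .proj₂) (component c' .proj₂ .proj₂)
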